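{- For a positive integer $m$ let $h(m)=2^{v_2(m)}3^{v_3(m)}$ and $S(m)=h(5m+1)$. Let $n=3^a$ with $a\ge 0$ an integer, and suppose $S(S(n))\neq n$. Then at least one of $S(n)$, $S(S(n))$, $S(S(S(n)))$ is strictly less than $n$.
   Context: $v_p(m)$ denotes the exponent of the prime $p$ in $m$; $h(m)$ is the largest divisor of $m$ whose only prime factors are $2$ and $3$. -}

module Defs where

open import Data.Nat using (ℕ; zero; suc; _+_; _*_; _^_; _≡ᵇ_)
open import Data.Nat.DivMod using (_/_; _%_)
open import Data.Bool using (if_then_else_)

-- valuation with fuel: number of times p divides m, counting at most `fuel` times.
-- p is written as suc (suc q) so that p ≥ 2 (and division is well-defined).
valF : ℕ → ℕ → ℕ → ℕ
valF q zero    m = 0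
valF q (suc f) m =
  if (m % suc (suc q)) ≡ᵇ 0 then suc (valF q f (m / suc (suc q))) else 0

-- v_p(m) for p = q + 2. For m ≥ 1 the fuel m is sufficient since v_p(m) ≤ log_2 m < m.
-- (For m = 0 the value is 0; never used below.)
v : ℕ → ℕ → ℕ
v p m = vp p m
  where
  vp : ℕ → ℕ → ℕ
  vp zero          m = 0
  vp (suc zero)    m = 0
  vp (suc (suc q)) m = valF q m m

h : ℕ → ℕ
h m = 2 ^ v 2 m * 3 ^ v 3 m

S : ℕ → ℕ
S m = h (5 * m + 1)

-- Let n = 3^a with a ≥ 2. Since 3 ∣ n, 5n + 1 is prime to 3 and 5, so S n = 2^k
-- is the 2-part of 5n + 1 = 2^k r with r odd. Either 2^k < n, or r < 6 and hence
-- r = 1, i.e. S n = 5n + 1. In the latter case 5 S n + 1 = 25n + 6 is odd and, as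
-- 9 ∣ n, exactly divisible by 3, so S (S n) = 3 < n. For a = 0 the hypothesis fails
-- (S (S 1) = 1), and a = 1 is a computation.

module Submission where

open import Defs
open import Data.Nat using (ℕ; zero; suc; _+_; _*_; _^_; _<_; _<?_; z<s; s<s; >-nonZero; nonTrivial⇒≢1)
open import Data.Nat.Properties
open import Data.Nat.DivMod using (_%_; m*n%n≡0; m*n/n≡m)
open import Data.Nat.Divisibility
open import Data.Nat.Primality using (Prime; prime[2]; prime⇒nonTrivial; euclidsLemma)
open import Data.Nat.Induction using (<-wellFounded)
open import Data.Nat.Tactic.RingSolver using (solve-∀)
open import Induction.WellFounded using (Acc; acc)
open import Data.Product using (∃; ∃₂; _×_; _,_)
open import Data.Sum using (_⊎_; inj₁; inj₂; [_,_]′; map₂)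
open import Function using (_∘_)
open import Relation.Nullary using (yes; no; contradiction)
open import Relation.Nullary.Decidable using (from-no)
open import Relation.Binary.PropositionalEquality
  using (_≡_; _≢_; refl; sym; trans; cong; cong₂; subst; module ≡-Reasoning)

n<m^n : ∀ {m} → 1 < m → ∀ n → n < m ^ n
n<m^n 1<m zero = z<s
n<m^n {m@(suc _)} 1<m (suc n) =
  ≤-<-trans (n<m^n 1<m n) (subst (m ^ n <_) (*-comm (m ^ n) m) (m<m*n (m ^ n) m {{m^n≢0 m n}} 1<m))

∣m∧∤n⇒∤m+n : ∀ {d m n} → d ∣ m → d ∤ n → d ∤ m + n
∣m∧∤n⇒∤m+n d∣m d∤n d∣m+n = d∤n (∣m+n∣m⇒∣n d∣m+n d∣m)

prime∤⇒∤^ : ∀ {p m} → Prime p → p ∤ m → ∀ b → p ∤ m ^ b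
prime∤⇒∤^ pp p∤m zero p∣1 = nonTrivial⇒≢1 {{prime⇒nonTrivial pp}} (∣1⇒≡1 p∣1)
prime∤⇒∤^ {m = m} pp p∤m (suc b) p∣m^[1+b] =
  [ p∤m , prime∤⇒∤^ pp p∤m b ]′ (euclidsLemma m (m ^ b) pp p∣m^[1+b])

-- The base is written 2 + q, so q = p ∸ 2 at use sites.
module _ (q : ℕ) where

  private
    p : ℕ
    p = suc (suc q)

  ∤⇒>0 : ∀ {r} → p ∤ r → 0 < r
  ∤⇒>0 {zero} p∤0 = contradiction (p ∣0) p∤0
  ∤⇒>0 {suc r} _ = z<s

  valF-∤ : ∀ {f m} → p ∤ m → valF q (suc f) m ≡ 0
  valF-∤ {m = m} p∤m with m % p in m%p≡
  ... | zero = contradiction (m%n≡0⇒n∣m m p m%p≡) p∤m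
  ... | suc _ = refl

  valF-*p : ∀ {f} m → valF q (suc f) (m * p) ≡ suc (valF q f m)
  valF-*p m rewrite m*n%n≡0 m p {{_}} | m*n/n≡m m p {{_}} = refl

  valF-p^k*r : ∀ {f k r} → p ∤ r → k < f → valF q f (p ^ k * r) ≡ k
  valF-p^k*r {suc f} {zero} {r} p∤r _ rewrite *-identityˡ r = valF-∤ {f} p∤r
  valF-p^k*r {suc f} {suc k} {r} p∤r (s<s k<f)
    rewrite trans (*-assoc p (p ^ k) r) (*-comm p (p ^ k * r))
    = trans (valF-*p {f} (p ^ k * r)) (cong suc (valF-p^k*r p∤r k<f))

  v-p^k*r : ∀ k {r} → p ∤ r → v p (p ^ k * r) ≡ k
  v-p^k*r k {r} p∤r = valF-p^k*r p∤r
    (<-≤-trans (n<m^n (s<s z<s) k) (m≤m*n (p ^ k) r {{>-nonZero (∤⇒>0 p∤r)}}))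

  v-∤ : ∀ {m} → p ∤ m → v p m ≡ 0
  v-∤ {m} p∤m = subst (λ x → v p x ≡ 0) (*-identityˡ m) (v-p^k*r 0 p∤m)

  p^k*-factorisation : ∀ m → Acc _<_ m → 0 < m → ∃₂ λ k r → m ≡ p ^ k * r × p ∤ r
  p^k*-factorisation m (acc rec) m>0 with p ∣? m
  ... | no p∤m = 0 , m , sym (*-identityˡ m) , p∤m
  ... | yes (divides c m≡c*p) with p^k*-factorisation c (rec c<m) c>0
    where
    c>0 : 0 < c
    c>0 = n≢0⇒n>0 λ { refl → <-irrefl (sym m≡c*p) m>0 }
    c<m : c < m
    c<m = subst (c <_) (sym m≡c*p) (m<m*n c p {{>-nonZero c>0}} (s<s z<s))
  ...   | k , r , c≡p^k*r , p∤r = suc k , r , m≡ , p∤r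
    where
    open ≡-Reasoning
    m≡ : m ≡ p ^ suc k * r
    m≡ = begin
      m               ≡⟨ m≡c*p ⟩
      c * p           ≡⟨ cong (_* p) c≡p^k*r ⟩
      p ^ k * r * p   ≡⟨ *-comm (p ^ k * r) p ⟩
      p * (p ^ k * r) ≡⟨ *-assoc p (p ^ k) r ⟨
      p ^ suc k * r   ∎

  p^v*-factorisation : ∀ {m} → 0 < m → ∃ λ r → m ≡ p ^ v p m * r × p ∤ r
  p^v*-factorisation {m} m>0 with p^k*-factorisation m (<-wellFounded m) m>0
  ... | k , r , m≡p^k*r , p∤r rewrite trans (cong (v p) m≡p^k*r) (v-p^k*r k p∤r) = r , m≡p^k*r , p∤r

∤2∧∤3∧∤5∧<6⇒≡1 : ∀ {r} → 2 ∤ r → 3 ∤ r → 5 ∤ r → r < 6 → r ≡ 1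
∤2∧∤3∧∤5∧<6⇒≡1 {0} 2∤r _ _ _ = contradiction (2 ∣0) 2∤r
∤2∧∤3∧∤5∧<6⇒≡1 {1} _ _ _ _ = refl
∤2∧∤3∧∤5∧<6⇒≡1 {2} 2∤r _ _ _ = contradiction ∣-refl 2∤r
∤2∧∤3∧∤5∧<6⇒≡1 {3} _ 3∤r _ _ = contradiction ∣-refl 3∤r
∤2∧∤3∧∤5∧<6⇒≡1 {4} 2∤r _ _ _ = contradiction (divides 2 refl) 2∤r
∤2∧∤3∧∤5∧<6⇒≡1 {5} _ _ 5∤r _ = contradiction ∣-refl 5∤r
∤2∧∤3∧∤5∧<6⇒≡1 {suc (suc (suc (suc (suc (suc _)))))} _ _ _ (s<s (s<s (s<s (s<s (s<s (s<s ()))))))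

S-small-or-full : ∀ {n} → 1 < n → 3 ∣ n → S n < n ⊎ S n ≡ 5 * n + 1
S-small-or-full {n} 1<n 3∣n = small-or-full (p^v*-factorisation 0 (m≤n+m 1 (5 * n)))
  where
  N k : ℕ
  N = 5 * n + 1
  k = v 2 N

  3∤N : 3 ∤ N
  3∤N = ∣m∧∤n⇒∤m+n (∣-trans 3∣n (n∣m*n 5)) (from-no (3 ∣? 1))

  5∤N : 5 ∤ N
  5∤N = ∣m∧∤n⇒∤m+n (m∣m*n n) (from-no (5 ∣? 1))

  Sn≡2^k : S n ≡ 2 ^ k
  Sn≡2^k = trans (cong (λ j → 2 ^ k * 3 ^ j) (v-∤ 1 3∤N)) (*-identityʳ (2 ^ k))

  small-or-full : (∃ λ r → N ≡ 2 ^ k * r × 2 ∤ r) → S n < n ⊎ S n ≡ N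
  small-or-full (r , N≡2^k*r , 2∤r) with 2 ^ k <? n
  ... | yes 2^k<n = inj₁ (subst (_< n) (sym Sn≡2^k) 2^k<n)
  ... | no 2^k≮n = inj₂ Sn≡N
    where
    ∤N⇒∤r : ∀ {d} → d ∤ N → d ∤ r
    ∤N⇒∤r {d} d∤N d∣r = d∤N (subst (d ∣_) (sym N≡2^k*r) (∣-trans d∣r (n∣m*n (2 ^ k))))

    r<6 : r < 6
    r<6 = *-cancelˡ-< (2 ^ k) r 6 (begin-strict
      2 ^ k * r  ≡⟨ N≡2^k*r ⟨
      5 * n + 1  <⟨ +-monoʳ-< (5 * n) 1<n ⟩
      5 * n + n  ≡⟨ +-comm (5 * n) n ⟩
      6 * n      ≤⟨ *-monoʳ-≤ 6 (≮⇒≥ 2^k≮n) ⟩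
      6 * 2 ^ k  ≡⟨ *-comm 6 (2 ^ k) ⟩
      2 ^ k * 6  ∎)
      where open ≤-Reasoning

    r≡1 : r ≡ 1
    r≡1 = ∤2∧∤3∧∤5∧<6⇒≡1 2∤r (∤N⇒∤r 3∤N) (∤N⇒∤r 5∤N) r<6

    Sn≡N : S n ≡ N
    Sn≡N = begin
      S n        ≡⟨ Sn≡2^k ⟩
      2 ^ k      ≡⟨ *-identityʳ (2 ^ k) ⟨
      2 ^ k * 1  ≡⟨ cong (2 ^ k *_) r≡1 ⟨
      2 ^ k * r  ≡⟨ N≡2^k*r ⟨
      N          ∎
      where open ≡-Reasoning

S-5n+1≡3 : ∀ {n} → 2 ∤ n → 9 ∣ n → S (5 * n + 1) ≡ 3
S-5n+1≡3 {n} 2∤n (divides y n≡y*9) = cong₂ (λ i j → 2 ^ i * 3 ^ j) v₂M≡0 v₃M≡1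
  where
  M R : ℕ
  M = 5 * (5 * n + 1) + 1
  R = 75 * y + 2

  M≡6+25n : M ≡ 6 + 25 * n
  M≡6+25n = identity n
    where
    identity : ∀ x → 5 * (5 * x + 1) + 1 ≡ 6 + 25 * x
    identity = solve-∀

  M≡3R : M ≡ 3 * R
  M≡3R = trans (cong (λ x → 5 * (5 * x + 1) + 1) n≡y*9) (identity y)
    where
    identity : ∀ x → 5 * (5 * (x * 9) + 1) + 1 ≡ 3 * (75 * x + 2)
    identity = solve-∀

  2∤25n : 2 ∤ 25 * n
  2∤25n 2∣25n = [ from-no (2 ∣? 25) , 2∤n ]′ (euclidsLemma 25 n prime[2] 2∣25n)

  3∤R : 3 ∤ R
  3∤R = ∣m∧∤n⇒∤m+n (∣-trans (divides 25 refl) (m∣m*n y)) (from-no (3 ∣? 2))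

  v₂M≡0 : v 2 M ≡ 0
  v₂M≡0 = v-∤ 0 (subst (2 ∤_) (sym M≡6+25n) (∣m∧∤n⇒∤m+n (divides 3 refl) 2∤25n))

  v₃M≡1 : v 3 M ≡ 1
  v₃M≡1 = trans (cong (v 3) M≡3R) (v-p^k*r 1 1 3∤R)

lemma4p2 : (a : ℕ) → S (S (3 ^ a)) ≢ 3 ^ a →
    (S (3 ^ a) < 3 ^ a) ⊎ (S (S (3 ^ a)) < 3 ^ a) ⊎ (S (S (S (3 ^ a))) < 3 ^ a)
lemma4p2 zero S²1≢1 = contradiction refl S²1≢1
-- S 3 = 16, S 16 = 81 and S 81 = h 406 = 2.
lemma4p2 (suc zero) _ = inj₂ (inj₂ (s<s (s<s z<s)))
lemma4p2 (suc (suc b)) _ = map₂ (inj₁ ∘ S²n<n) (S-small-or-full 1<n (m∣m*n {3} (3 ^ suc b)))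
  where
  n : ℕ
  n = 3 ^ suc (suc b)

  3<n : 3 < n
  3<n = ^-monoʳ-< 3 (s<s z<s) {1} {suc (suc b)} (s<s z<s)

  1<n : 1 < n
  1<n = <-trans (s<s z<s) 3<n

  2∤n : 2 ∤ n
  2∤n = prime∤⇒∤^ prime[2] (from-no (2 ∣? 3)) (suc (suc b))

  9∣n : 9 ∣ n
  9∣n = divides (3 ^ b) (trans (sym (*-assoc 3 3 (3 ^ b))) (*-comm 9 (3 ^ b)))

  S²n<n : S n ≡ 5 * n + 1 → S (S n) < n
  S²n<n Sn≡5n+1 = subst (_< n) (sym (trans (cong S Sn≡5n+1) (S-5n+1≡3 2∤n 9∣n))) 3<n
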